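{- Let $\mathbf{L}$ be an intermediate logic and let $\mathbf{LJL}\in\{\mathbf{LJ},\mathbf{LJT},\mathbf{LJ4},\mathbf{LJT4}\}$ be a corresponding intermediate justification logic (with total constant specification). Let $\mathfrak{M}^{sc}:=\mathfrak{M}^{sc}(\mathbf{LJL})=\langle\mathcal{W}^{sc},\preceq^{sc},\mathcal{R}^{sc},\mathcal{E}^{sc},\Vdash^{sc}\rangle$ be the standard canonical intuitionistic Fitting model for $\mathbf{LJL}$ and define the intuitionistic modal Kripke model $\mathfrak{N}:=\langle\mathcal{W}^{sc},\preceq^{sc},\mathcal{R}^{sc},\Vdash^{sc}\rangle$. For all uniquely annotated $\phi'\in\mathcal{L}'_{\Box}$ and all $\tau\in\mathcal{W}^{sc}$: \begin{enumerate} \item if $(\mathfrak{M}^{sc},\tau)\models\alpha$ for all $(T,\alpha)\in\mathrm{Quasi}[T,\phi']$, then $(\mathfrak{N},\tau)\models(\phi')^\bullet$; \item if $(\mathfrak{M}^{sc},\tau)\not\models\alpha$ for all $(F,\alpha)\in\mathrm{Quasi}[F,\phi']$, then $(\mathfrak{N},\tau)\not\models(\phi')^\bullet$. \end{enumerate}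
   Context: $\mathcal{L}'_\Box$ is the modal language with indexed boxes $\Box_n$ ($n\in\mathbb{N}$); $(\cdot)^\bullet$ erases indices; $\phi'$ is uniquely annotated if no index occurs twice. A tableau is a pair $(\Gamma,\Delta)$ of sets of justification formulae; it is $\mathbf{LJL}$-consistent if $\Gamma\not\vdash_{\mathbf{LJL}}\phi_1\lor\dots\lor\phi_n$ for all $\phi_i\in\Delta$, and maximal if $\Gamma\cup\Delta=\mathcal{L}_J$. The standard canonical model has: $\mathcal{W}^{sc}$ the maximal $\mathbf{LJL}$-consistent tableaux; $(\Gamma,\Delta)\preceq^{sc}(\Gamma',\Delta')$ iff $\Gamma\subseteq\Gamma'$; $(\Gamma,\Delta)\mathcal{R}^{sc}(\Gamma',\Delta')$ iff $\Gamma^\#\subseteq\Gamma'$ where $\Gamma^\#=\{\phi\mid t:\phi\in\Gamma\text{ for some }t\}$; $\mathcal{E}^{sc}_t(\tau)=\{\phi\mid t:\phi\in\Gamma\}$; $\tau\Vdash^{sc}p$ iff $p\in\Gamma$. The map $\mathrm{Quasi}[\cdot]:\{T,F\}\times\mathcal{L}'_\Box\to\mathcal{P}(\{T,F\}\times\mathcal{L}_J)$ is defined recursively: for $\phi'\in Var\cup\{\bot\}$, $\mathrm{Quasi}[T,\phi']=\{(T,\phi')\}$, $\mathrm{Quasi}[F,\phi']=\{(F,\phi')\}$; for $\circ\in\{\land,\lor\}$, $\mathrm{Quasi}[T,\phi'\circ\psi']=\{(T,\alpha\circ\beta)\mid(T,\alpha)\in\mathrm{Quasi}[T,\phi'],(T,\beta)\in\mathrm{Quasi}[T,\psi']\}$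 and likewise with $F$; $\mathrm{Quasi}[T,\phi'\rightarrow\psi']=\{(T,\alpha\rightarrow\beta)\mid(F,\alpha)\in\mathrm{Quasi}[F,\phi'],(T,\beta)\in\mathrm{Quasi}[T,\psi']\}$; $\mathrm{Quasi}[F,\phi'\rightarrow\psi']=\{(F,\bigwedge_{i=1}^k\alpha_i\rightarrow\bigvee_{j=1}^l\beta_j)\mid(T,\alpha_i)\in\mathrm{Quasi}[T,\phi'],(F,\beta_j)\in\mathrm{Quasi}[F,\psi']\}$; $\mathrm{Quasi}[T,\Box_n\phi']=\{(T,x_n:\alpha)\mid(T,\alpha)\in\mathrm{Quasi}[T,\phi']\}$; $\mathrm{Quasi}[F,\Box_n\phi']=\{(F,t:(\alpha_1\lor\dots\lor\alpha_m))\mid(F,\alpha_i)\in\mathrm{Quasi}[F,\phi'],t\in Jt\}$. -}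

module Defs where

open import Level using (0ℓ)
open import Data.Nat using (ℕ)
open import Data.Bool using (Bool; true; false; _∧_; _∨_; not)
open import Data.List using (List; []; _∷_; _++_)
open import Data.List.Relation.Unary.All using (All)
open import Data.List.Relation.Unary.Unique.Propositional using (Unique)
open import Data.List.Membership.Propositional using () renaming (_∈_ to _∈ₗ_)
open import Data.Product using (_×_; _,_; Σ)
open import Data.Sum using (_⊎_)
open import Data.Empty using (⊥)
open import Relation.Nullary using (¬_)
open import Relation.Binary.PropositionalEquality using (_≡_)
open import Relation.Unary using (Pred; _∈_; _∉_; _⊆_)

infixr 6 _∧ₚ_
infixr 5 _∨ₚ_
infixr 4 _⇒ₚ_

data PFm : Set where
  pvar : ℕ → PFm
  ⊥ₚ   : PFm
  _∧ₚ_ _∨ₚ_ _⇒ₚ_ : PFm → PFm → PFm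

data IPC⊢_ : PFm → Set where
  a1 : ∀ A B → IPC⊢ (A ⇒ₚ (B ⇒ₚ A))
  a2 : ∀ A B C → IPC⊢ ((A ⇒ₚ (B ⇒ₚ C)) ⇒ₚ ((A ⇒ₚ B) ⇒ₚ (A ⇒ₚ C)))
  a3 : ∀ A B → IPC⊢ ((A ∧ₚ B) ⇒ₚ A)
  a4 : ∀ A B → IPC⊢ ((A ∧ₚ B) ⇒ₚ B)
  a5 : ∀ A B → IPC⊢ (A ⇒ₚ (B ⇒ₚ (A ∧ₚ B)))
  a6 : ∀ A B → IPC⊢ (A ⇒ₚ (A ∨ₚ B))
  a7 : ∀ A B → IPC⊢ (B ⇒ₚ (A ∨ₚ B))
  a8 : ∀ A B C → IPC⊢ ((A ⇒ₚ C) ⇒ₚ ((B ⇒ₚ C) ⇒ₚ ((A ∨ₚ B) ⇒ₚ C)))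
  a9 : ∀ A → IPC⊢ (⊥ₚ ⇒ₚ A)
  mp : ∀ {A B} → IPC⊢ (A ⇒ₚ B) → IPC⊢ A → IPC⊢ B

evalB : (ℕ → Bool) → PFm → Bool
evalB v (pvar p)  = v p
evalB v ⊥ₚ        = false
evalB v (A ∧ₚ B)  = evalB v A ∧ evalB v B
evalB v (A ∨ₚ B)  = evalB v A ∨ evalB v B
evalB v (A ⇒ₚ B)  = not (evalB v A) ∨ evalB v B

Tautology : PFm → Set
Tautology A = ∀ v → evalB v A ≡ true

substP : (ℕ → PFm) → PFm → PFm
substP σ (pvar p) = σ p
substP σ ⊥ₚ       = ⊥ₚ
substP σ (A ∧ₚ B) = substP σ A ∧ₚ substP σ B
substP σ (A ∨ₚ B) = substP σ A ∨ₚ substP σ B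
substP σ (A ⇒ₚ B) = substP σ A ⇒ₚ substP σ B

record IntermediateLogic : Set₁ where
  field
    Thm        : Pred PFm 0ℓ
    ipc        : ∀ A → IPC⊢ A → A ∈ Thm
    closedMP   : ∀ A B → (A ⇒ₚ B) ∈ Thm → A ∈ Thm → B ∈ Thm
    closedSub  : ∀ σ A → A ∈ Thm → substP σ A ∈ Thm
    classical  : ∀ A → A ∈ Thm → Tautology A

infixl 7 _·_
infixl 6 _⊕_

data Jt : Set where
  jvar   : ℕ → Jt
  jconst : ℕ → Jt
  _·_    : Jt → Jt → Jt
  _⊕_    : Jt → Jt → Jt
  !_     : Jt → Jt

infixr 8 _∶_
infixr 6 _∧ⱼ_
infixr 5 _∨ⱼ_
infixr 4 _⇒ⱼ_

data JFm : Set where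
  jatom : ℕ → JFm
  ⊥ⱼ    : JFm
  _∧ⱼ_ _∨ⱼ_ _⇒ⱼ_ : JFm → JFm → JFm
  _∶_   : Jt → JFm → JFm

substJ : (ℕ → JFm) → PFm → JFm
substJ σ (pvar p) = σ p
substJ σ ⊥ₚ       = ⊥ⱼ
substJ σ (A ∧ₚ B) = substJ σ A ∧ⱼ substJ σ B
substJ σ (A ∨ₚ B) = substJ σ A ∨ⱼ substJ σ B
substJ σ (A ⇒ₚ B) = substJ σ A ⇒ⱼ substJ σ B

⋀⁺ : JFm → List JFm → JFm
⋀⁺ a []       = a
⋀⁺ a (b ∷ bs) = a ∧ⱼ ⋀⁺ b bs

⋁⁺ : JFm → List JFm → JFm
⋁⁺ a []       = a
⋁⁺ a (b ∷ bs) = a ∨ⱼ ⋁⁺ b bs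

⋁ : List JFm → JFm
⋁ []       = ⊥ⱼ
⋁ (a ∷ as) = ⋁⁺ a as

data Variant : Set where
  J JT J4 JT4 : Variant

hasT : Variant → Bool
hasT J   = false
hasT JT  = true
hasT J4  = false
hasT JT4 = true

has4 : Variant → Bool
has4 J   = false
has4 JT  = false
has4 J4  = true
has4 JT4 = true

module _ (L : IntermediateLogic) (V : Variant) where
  open IntermediateLogic L

  data BaseAx : JFm → Set where
    axL  : ∀ σ A → A ∈ Thm → BaseAx (substJ σ A)
    axJ  : ∀ s t φ ψ → BaseAx (s ∶ (φ ⇒ⱼ ψ) ⇒ⱼ (t ∶ φ ⇒ⱼ (s · t) ∶ ψ))
    axJ+ˡ : ∀ s t φ → BaseAx (s ∶ φ ⇒ⱼ (s ⊕ t) ∶ φ)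
    axJ+ʳ : ∀ s t φ → BaseAx (t ∶ φ ⇒ⱼ (s ⊕ t) ∶ φ)
    axT  : hasT V ≡ true → ∀ t φ → BaseAx (t ∶ φ ⇒ⱼ φ)
    ax4  : has4 V ≡ true → ∀ t φ → BaseAx (t ∶ φ ⇒ⱼ (! t) ∶ (t ∶ φ))

  -- total constant specification: c_{i_n} : ... : c_{i_1} : A  for every axiom A, n ≥ 1
  data CS : JFm → Set where
    csBase : ∀ i A → BaseAx A → CS (jconst i ∶ A)
    csStep : ∀ i φ → CS φ → CS (jconst i ∶ φ)

  data Ax : JFm → Set where
    base : ∀ {φ} → BaseAx φ → Ax φ
    cs   : ∀ {φ} → CS φ → Ax φ

  -- derivability from a set of premises (rules: MP; axiom necessitation is via CS)
  data _⊢_ (Γ : Pred JFm 0ℓ) : JFm → Set where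
    ax  : ∀ {φ} → Ax φ → Γ ⊢ φ
    hyp : ∀ {φ} → φ ∈ Γ → Γ ⊢ φ
    mp  : ∀ {φ ψ} → Γ ⊢ (φ ⇒ⱼ ψ) → Γ ⊢ φ → Γ ⊢ ψ

  Consistent : Pred JFm 0ℓ → Pred JFm 0ℓ → Set
  Consistent Γ Δ = ∀ (φs : List JFm) → All (_∈ Δ) φs → ¬ (Γ ⊢ ⋁ φs)

  Maximal : Pred JFm 0ℓ → Pred JFm 0ℓ → Set
  Maximal Γ Δ = ∀ φ → φ ∈ Γ ⊎ φ ∈ Δ

  record Tableau : Set₁ where
    constructor tableau
    field
      Γ Δ        : Pred JFm 0ℓ
      consistent : Consistent Γ Δ
      maximal    : Maximal Γ Δ

record FittingModel : Set₂ where
  field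
    W   : Set₁
    _≼_ : W → W → Set
    R   : W → W → Set
    E   : Jt → W → Pred JFm 0ℓ
    Val : W → ℕ → Set

module _ (M : FittingModel) where
  open FittingModel M
  infix 3 _⊨ᶠ_
  _⊨ᶠ_ : W → JFm → Set₁
  w ⊨ᶠ jatom p   = Level.Lift (Level.suc 0ℓ) (Val w p)
  w ⊨ᶠ ⊥ⱼ        = Level.Lift (Level.suc 0ℓ) ⊥
  w ⊨ᶠ (φ ∧ⱼ ψ)  = (w ⊨ᶠ φ) × (w ⊨ᶠ ψ)
  w ⊨ᶠ (φ ∨ⱼ ψ)  = (w ⊨ᶠ φ) ⊎ (w ⊨ᶠ ψ)
  w ⊨ᶠ (φ ⇒ⱼ ψ)  = ∀ v → w ≼ v → v ⊨ᶠ φ → v ⊨ᶠ ψ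
  w ⊨ᶠ (t ∶ φ)   = Level.Lift (Level.suc 0ℓ) (φ ∈ E t w) × (∀ v → R w v → v ⊨ᶠ φ)

infixr 6 _∧ₘ_
infixr 5 _∨ₘ_
infixr 4 _⇒ₘ_

data MFm : Set where
  matom : ℕ → MFm
  ⊥ₘ    : MFm
  _∧ₘ_ _∨ₘ_ _⇒ₘ_ : MFm → MFm → MFm
  □_    : MFm → MFm

infixr 6 _∧ᵢ_
infixr 5 _∨ᵢ_
infixr 4 _⇒ᵢ_

data IFm : Set where
  iatom : ℕ → IFm
  ⊥ᵢ    : IFm
  _∧ᵢ_ _∨ᵢ_ _⇒ᵢ_ : IFm → IFm → IFm
  □[_]_ : ℕ → IFm → IFm

erase : IFm → MFm
erase (iatom p)  = matom p
erase ⊥ᵢ         = ⊥ₘ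
erase (φ ∧ᵢ ψ)   = erase φ ∧ₘ erase ψ
erase (φ ∨ᵢ ψ)   = erase φ ∨ₘ erase ψ
erase (φ ⇒ᵢ ψ)   = erase φ ⇒ₘ erase ψ
erase (□[ n ] φ) = □ erase φ

indices : IFm → List ℕ
indices (iatom p)  = []
indices ⊥ᵢ         = []
indices (φ ∧ᵢ ψ)   = indices φ ++ indices ψ
indices (φ ∨ᵢ ψ)   = indices φ ++ indices ψ
indices (φ ⇒ᵢ ψ)   = indices φ ++ indices ψ
indices (□[ n ] φ) = n ∷ indices φ

UniquelyAnnotated : IFm → Set
UniquelyAnnotated φ = Unique (indices φ)

record ModalModel : Set₂ where
  field
    W   : Set₁
    _≼_ : W → W → Set
    R   : W → W → Set
    Val : W → ℕ → Set

module _ (N : ModalModel) where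
  open ModalModel N
  infix 3 _⊨ᵐ_
  _⊨ᵐ_ : W → MFm → Set₁
  w ⊨ᵐ matom p   = Level.Lift (Level.suc 0ℓ) (Val w p)
  w ⊨ᵐ ⊥ₘ        = Level.Lift (Level.suc 0ℓ) ⊥
  w ⊨ᵐ (φ ∧ₘ ψ)  = (w ⊨ᵐ φ) × (w ⊨ᵐ ψ)
  w ⊨ᵐ (φ ∨ₘ ψ)  = (w ⊨ᵐ φ) ⊎ (w ⊨ᵐ ψ)
  w ⊨ᵐ (φ ⇒ₘ ψ)  = ∀ v → w ≼ v → v ⊨ᵐ φ → v ⊨ᵐ ψ
  w ⊨ᵐ (□ φ)     = ∀ v → R w v → v ⊨ᵐ φ

module Canonical (L : IntermediateLogic) (V : Variant) where
  open Tableau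

  Wsc : Set₁
  Wsc = Tableau L V

  _≼sc_ : Wsc → Wsc → Set
  τ ≼sc τ' = Γ τ ⊆ Γ τ'

  Rsc : Wsc → Wsc → Set
  Rsc τ τ' = ∀ t φ → (t ∶ φ) ∈ Γ τ → φ ∈ Γ τ'

  Esc : Jt → Wsc → Pred JFm 0ℓ
  Esc t τ φ = (t ∶ φ) ∈ Γ τ

  Valsc : Wsc → ℕ → Set
  Valsc τ p = jatom p ∈ Γ τ

  Msc : FittingModel
  Msc = record { W = Wsc ; _≼_ = _≼sc_ ; R = Rsc ; E = Esc ; Val = Valsc }

  Nsc : ModalModel
  Nsc = record { W = Wsc ; _≼_ = _≼sc_ ; R = Rsc ; Val = Valsc }

data Pol : Set where
  T F : Pol

-- Quasi b φ' (b' , α)  means  (b' , α) ∈ Quasi[b , φ']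
data Quasi : Pol → IFm → Pol × JFm → Set where
  qT-atom : ∀ p → Quasi T (iatom p) (T , jatom p)
  qF-atom : ∀ p → Quasi F (iatom p) (F , jatom p)
  qT-⊥    : Quasi T ⊥ᵢ (T , ⊥ⱼ)
  qF-⊥    : Quasi F ⊥ᵢ (F , ⊥ⱼ)
  qT-∧    : ∀ {φ ψ α β} → Quasi T φ (T , α) → Quasi T ψ (T , β) → Quasi T (φ ∧ᵢ ψ) (T , α ∧ⱼ β)
  qF-∧    : ∀ {φ ψ α β} → Quasi F φ (F , α) → Quasi F ψ (F , β) → Quasi F (φ ∧ᵢ ψ) (F , α ∧ⱼ β)
  qT-∨    : ∀ {φ ψ α β} → Quasi T φ (T , α) → Quasi T ψ (T , β) → Quasi T (φ ∨ᵢ ψ) (T , α ∨ⱼ β)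
  qF-∨    : ∀ {φ ψ α β} → Quasi F φ (F , α) → Quasi F ψ (F , β) → Quasi F (φ ∨ᵢ ψ) (F , α ∨ⱼ β)
  qT-⇒    : ∀ {φ ψ α β} → Quasi F φ (F , α) → Quasi T ψ (T , β) → Quasi T (φ ⇒ᵢ ψ) (T , α ⇒ⱼ β)
  qF-⇒    : ∀ {φ ψ} α αs β βs →
            All (λ a → Quasi T φ (T , a)) (α ∷ αs) →
            All (λ b → Quasi F ψ (F , b)) (β ∷ βs) →
            Quasi F (φ ⇒ᵢ ψ) (F , ⋀⁺ α αs ⇒ⱼ ⋁⁺ β βs)
  qT-□    : ∀ {n φ α} → Quasi T φ (T , α) → Quasi T (□[ n ] φ) (T , jvar n ∶ α)
  qF-□    : ∀ {n φ} α αs (t : Jt) →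
            All (λ a → Quasi F φ (F , a)) (α ∷ αs) →
            Quasi F (□[ n ] φ) (F , t ∶ ⋁⁺ α αs)

module Submission where

-- The proof is by induction on φ', proving simultaneously
--   (T) if every α with (T , α) ∈ Quasi[T , φ'] is forced at τ, then τ ⊨ (φ')•;
--   (F) if τ ⊨ (φ')•, then some α with (F , α) ∈ Quasi[F , φ'] is forced at τ,
-- where (F) immediately yields the second claim.  The propositional cases only
-- use the semantic clauses (the ∨ case of (T) needs excluded middle).  The cases
-- (F , ⇒) and (F , □) are the heart of the argument: either the pair
-- (Γ ∪ Quasi-T-part , Quasi-F-part), resp. (Γ^# , Quasi-F-part), extends to a
-- maximal consistent tableau, which contradicts the induction hypothesis, or it is
-- refuted by a finite derivation, which compactness (for ⇒) or the lifting lemma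
-- (for □) turns into a single quasi-realization that belongs to Γ.

open import Defs renaming (_⊢_ to Derivable)
import Level
open import Level using (0ℓ; lift; lower)
open import Data.List using (List; []; _∷_; _++_; map; cartesianProductWith)
import Data.List.Relation.Unary.All as All
open import Data.List.Relation.Unary.All using (All; []; _∷_)
open import Data.List.Relation.Unary.All.Properties using (++⁺)
open import Data.List.Relation.Unary.Any using (here; there)
open import Data.List.Membership.Propositional using () renaming (_∈_ to _∈ₗ_)
open import Data.List.Membership.Propositional.Properties
  using (∈-++⁺ˡ; ∈-++⁺ʳ; ∈-map⁺; ∈-cartesianProductWith⁺)
open import Data.Product using (_×_; _,_; Σ; proj₁; proj₂)
open import Data.Sum using (_⊎_; inj₁; inj₂; fromInj₂)
import Data.Sum as Sum
open import Data.Empty using (⊥-elim)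
open import Function using (_∘_)
open import Relation.Nullary using (¬_; Dec; yes; no; contradiction)
open import Relation.Nullary.Decidable using (map′)
open import Relation.Binary.PropositionalEquality using (refl)
open import Relation.Unary using (Pred; _∈_; _⊆_; _∪_; ｛_｝)
open import Axiom.ExcludedMiddle using (ExcludedMiddle)
open import Axiom.DoubleNegationElimination using (DoubleNegationElimination; em⇒dne)

partition-∪ : {A : Set} {P Q : Pred A 0ℓ} {xs : List A} → All (P ∪ Q) xs →
  Σ (List A) λ ys → All P ys × (∀ {x} → x ∈ₗ xs → x ∈ₗ ys ⊎ x ∈ Q)
partition-∪ [] = [] , [] , λ ()
partition-∪ {xs = x ∷ _} (inj₁ p ∷ ps) with partition-∪ ps
... | ys , qs , cover = x ∷ ys , p ∷ qs , λ { (here refl) → inj₁ (here refl) ; (there m) → Sum.map₁ there (cover m) }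
partition-∪ (inj₂ q ∷ ps) with partition-∪ ps
... | ys , qs , cover = ys , qs , λ { (here refl) → inj₂ q ; (there m) → cover m }

module Hilbert (L : IntermediateLogic) (V : Variant) where
  open IntermediateLogic L using (ipc)
  open import Data.Nat using (ℕ; zero; suc)

  infix 3 _⊢_
  _⊢_ : Pred JFm 0ℓ → JFm → Set
  _⊢_ = Derivable L V

  private
    variable
      Γ Θ Ξ : Pred JFm 0ℓ
      φ ψ χ : JFm
      ds : List JFm

  ipc-instance : (σ : ℕ → JFm) {A : PFm} → IPC⊢ A → Γ ⊢ substJ σ A
  ipc-instance σ {A} p = ax (base (axL σ A (ipc A p)))

  σ₃ : JFm → JFm → JFm → ℕ → JFm
  σ₃ a b c zero          = a
  σ₃ a b c (suc zero)    = b
  σ₃ a b c (suc (suc _)) = c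

  K : ∀ a b → Γ ⊢ a ⇒ⱼ b ⇒ⱼ a
  K a b = ipc-instance (σ₃ a b a) (a1 (pvar 0) (pvar 1))

  S : ∀ a b c → Γ ⊢ (a ⇒ⱼ b ⇒ⱼ c) ⇒ⱼ (a ⇒ⱼ b) ⇒ⱼ a ⇒ⱼ c
  S a b c = ipc-instance (σ₃ a b c) (a2 (pvar 0) (pvar 1) (pvar 2))

  ∧-elimˡ : ∀ a b → Γ ⊢ a ∧ⱼ b ⇒ⱼ a
  ∧-elimˡ a b = ipc-instance (σ₃ a b a) (a3 (pvar 0) (pvar 1))

  ∧-elimʳ : ∀ a b → Γ ⊢ a ∧ⱼ b ⇒ⱼ b
  ∧-elimʳ a b = ipc-instance (σ₃ a b a) (a4 (pvar 0) (pvar 1))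

  ∧-intro : ∀ a b → Γ ⊢ a ⇒ⱼ b ⇒ⱼ a ∧ⱼ b
  ∧-intro a b = ipc-instance (σ₃ a b a) (a5 (pvar 0) (pvar 1))

  ∨-introˡ : ∀ a b → Γ ⊢ a ⇒ⱼ a ∨ⱼ b
  ∨-introˡ a b = ipc-instance (σ₃ a b a) (a6 (pvar 0) (pvar 1))

  ∨-introʳ : ∀ a b → Γ ⊢ b ⇒ⱼ a ∨ⱼ b
  ∨-introʳ a b = ipc-instance (σ₃ a b a) (a7 (pvar 0) (pvar 1))

  ∨-elim : ∀ a b c → Γ ⊢ (a ⇒ⱼ c) ⇒ⱼ (b ⇒ⱼ c) ⇒ⱼ a ∨ⱼ b ⇒ⱼ c
  ∨-elim a b c = ipc-instance (σ₃ a b c) (a8 (pvar 0) (pvar 1) (pvar 2))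

  ex-falso : ∀ a → Γ ⊢ ⊥ⱼ ⇒ⱼ a
  ex-falso a = ipc-instance (σ₃ a a a) (a9 (pvar 0))

  ⇒-refl : ∀ a → Γ ⊢ a ⇒ⱼ a
  ⇒-refl a = mp (mp (S a (a ⇒ⱼ a) a) (K a (a ⇒ⱼ a))) (K a a)

  ⇒-mp : Γ ⊢ χ ⇒ⱼ φ ⇒ⱼ ψ → Γ ⊢ χ ⇒ⱼ φ → Γ ⊢ χ ⇒ⱼ ψ
  ⇒-mp {χ = χ} {φ} {ψ} d e = mp (mp (S χ φ ψ) d) e

  weaken : Θ ⊆ Ξ → Θ ⊢ φ → Ξ ⊢ φ
  weaken s (ax x)   = ax x
  weaken s (hyp x)  = hyp (s x)
  weaken s (mp d e) = mp (weaken s d) (weaken s e)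

  deduction : Γ ∪ ｛ φ ｝ ⊢ ψ → Γ ⊢ φ ⇒ⱼ ψ
  deduction {φ = φ} (ax {ψ} x)         = mp (K ψ φ) (ax x)
  deduction {φ = φ} (hyp {ψ} (inj₁ x)) = mp (K ψ φ) (hyp x)
  deduction {φ = φ} (hyp (inj₂ refl))  = ⇒-refl φ
  deduction (mp d e)                   = ⇒-mp (deduction d) (deduction e)

  undeduction : Γ ⊢ φ ⇒ⱼ ψ → Γ ∪ ｛ φ ｝ ⊢ ψ
  undeduction d = mp (weaken inj₁ d) (hyp (inj₂ refl))

  ⇒-trans : Γ ⊢ φ ⇒ⱼ ψ → Γ ⊢ ψ ⇒ⱼ χ → Γ ⊢ φ ⇒ⱼ χ
  ⇒-trans d e = deduction (mp (weaken inj₁ e) (undeduction d))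

  ⋁-intro : ∀ ds → χ ∈ₗ ds → Γ ⊢ χ ⇒ⱼ ⋁ ds
  ⋁-intro (a ∷ [])     (here refl) = ⇒-refl a
  ⋁-intro (a ∷ [])     (there ())
  ⋁-intro (a ∷ b ∷ bs) (here refl) = ∨-introˡ a (⋁⁺ b bs)
  ⋁-intro (a ∷ b ∷ bs) (there m)   = ⇒-trans (⋁-intro (b ∷ bs) m) (∨-introʳ a (⋁⁺ b bs))

  ⋁-elim : All (λ d → Γ ⊢ d ⇒ⱼ χ) ds → Γ ⊢ ⋁ ds ⇒ⱼ χ
  ⋁-elim {χ = χ} []                = ex-falso χ
  ⋁-elim (p ∷ [])                  = p
  ⋁-elim {χ = χ} (p ∷ ps@(_ ∷ _)) = mp (mp (∨-elim _ _ χ) p) (⋁-elim ps)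

  ⋁-sub : ∀ ds es → (∀ {x} → x ∈ₗ ds → x ∈ₗ es) → Γ ⊢ ⋁ ds ⇒ⱼ ⋁ es
  ⋁-sub ds es s = ⋁-elim (All.tabulate (λ m → ⋁-intro es (s m)))

  ⋀-elim : ∀ a as → χ ∈ₗ a ∷ as → Γ ⊢ ⋀⁺ a as ⇒ⱼ χ
  ⋀-elim a []       (here refl) = ⇒-refl a
  ⋀-elim a []       (there ())
  ⋀-elim a (b ∷ bs) (here refl) = ∧-elimˡ a (⋀⁺ b bs)
  ⋀-elim a (b ∷ bs) (there m)   = ⇒-trans (∧-elimʳ a (⋀⁺ b bs)) (⋀-elim b bs m)

  ⋀-intro : ∀ a as → All (λ x → Γ ⊢ χ ⇒ⱼ x) (a ∷ as) → Γ ⊢ χ ⇒ⱼ ⋀⁺ a as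
  ⋀-intro a []       (p ∷ [])  = p
  ⋀-intro a (b ∷ bs) (p ∷ ps)  = ⇒-mp (⇒-mp (mp (K _ _) (∧-intro a (⋀⁺ b bs))) p) (⋀-intro b bs ps)

  ⋀-sub : ∀ a as bs → (∀ {x} → x ∈ₗ as → x ∈ₗ bs) → Γ ⊢ ⋀⁺ a bs ⇒ⱼ ⋀⁺ a as
  ⋀-sub a as bs s = ⋀-intro a as (All.tabulate λ
    { (here refl) → ⋀-elim a bs (here refl)
    ; (there m)   → ⋀-elim a bs (there (s m)) })

  -- Compactness: a derivation from Γ ∪ P uses finitely many hypotheses hs from P.
  -- An arbitrary formula a is added as an extra conjunct, so the conjunction is nonempty.
  compactness : {P : Pred JFm 0ℓ} (a : JFm) → Γ ∪ P ⊢ χ →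
    Σ (List JFm) λ hs → All P hs × Γ ⊢ ⋀⁺ a hs ⇒ⱼ χ
  compactness a (ax {φ} x)         = [] , [] , mp (K φ a) (ax x)
  compactness a (hyp {φ} (inj₁ x)) = [] , [] , mp (K φ a) (hyp x)
  compactness a (hyp {φ} (inj₂ p)) = φ ∷ [] , p ∷ [] , ⋀-elim a (φ ∷ []) (there (here refl))
  compactness a (mp d e) with compactness a d | compactness a e
  ... | hs , hs∈P , d′ | ks , ks∈P , e′ =
    hs ++ ks , ++⁺ hs∈P ks∈P ,
    ⇒-mp (⇒-trans (⋀-sub a hs (hs ++ ks) ∈-++⁺ˡ) d′)
         (⇒-trans (⋀-sub a ks (hs ++ ks) (∈-++⁺ʳ hs)) e′)

  nonempty-⋁ : {P : Pred JFm 0ℓ} {b₀ : JFm} → P b₀ → All P ds →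
    Σ JFm λ b → Σ (List JFm) λ bs → All P (b ∷ bs) × Γ ⊢ ⋁ ds ⇒ⱼ ⋁⁺ b bs
  nonempty-⋁ {b₀ = b₀} p []              = b₀ , [] , p ∷ [] , ex-falso b₀
  nonempty-⋁ {ds = d ∷ ds} p ps@(_ ∷ _) = d , ds , ps , ⇒-refl (⋁⁺ d ds)

  _♯ : Pred JFm 0ℓ → Pred JFm 0ℓ
  (Γ ♯) φ = Σ Jt λ t → (t ∶ φ) ∈ Γ

  -- Lifting lemma: what follows from Γ^# has a justification following from Γ.
  -- Axioms are justified by constants (the constant specification is total),
  -- and modus ponens by application.
  lifting : Γ ♯ ⊢ φ → Σ Jt λ t → Γ ⊢ t ∶ φ
  lifting (ax (base x))       = jconst 0 , ax (cs (csBase 0 _ x))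
  lifting (ax (cs x))         = jconst 0 , ax (cs (csStep 0 _ x))
  lifting (hyp (t , m))       = t , hyp m
  lifting (mp {φ} {ψ} d e) with lifting d | lifting e
  ... | s , d′ | t , e′ = s · t , mp (mp (ax (base (axJ s t φ ψ))) d′) e′

  consistent-right : Consistent L V Θ Ξ → ¬ Consistent L V (Θ ∪ ｛ φ ｝) Ξ →
    Consistent L V Θ (Ξ ∪ ｛ φ ｝)
  consistent-right {Θ} {Ξ} {φ} con ¬con ds ds∈ ⊢ds = ¬con λ es es∈Ξ ⊢es →
    let ys , ys∈Ξ , cover = partition-∪ ds∈
        each : All (λ x → Θ ⊢ x ⇒ⱼ ⋁ (es ++ ys)) ds
        each = All.tabulate λ m → covered es ⊢es (cover m)
    in con (es ++ ys) (++⁺ es∈Ξ ys∈Ξ) (mp (⋁-elim each) ⊢ds)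
    where
    covered : ∀ es {ys x} → Θ ∪ ｛ φ ｝ ⊢ ⋁ es → x ∈ₗ ys ⊎ x ∈ ｛ φ ｝ → Θ ⊢ x ⇒ⱼ ⋁ (es ++ ys)
    covered es {ys} _   (inj₁ m)    = ⋁-intro (es ++ ys) (∈-++⁺ʳ es m)
    covered es {ys} ⊢es (inj₂ refl) = ⇒-trans (deduction ⊢es) (⋁-sub es (es ++ ys) ∈-++⁺ˡ)

module Classical (em : ExcludedMiddle (Level.suc 0ℓ)) where

  em₀ : ExcludedMiddle 0ℓ
  em₀ = map′ lower lift em

  dne₀ : DoubleNegationElimination 0ℓ
  dne₀ = em⇒dne em₀

  all-or-counterexample : {A : Set} (P : A → Set) (Q : A → Set₁) →
    (∀ x → P x → Q x) ⊎ Σ A λ x → P x × ¬ Q x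
  all-or-counterexample P Q with em {∀ x → P x → Q x}
  ... | yes all = inj₁ all
  ... | no ¬all = inj₂ (em⇒dne em λ no-cex →
          ¬all λ x p → em⇒dne em λ ¬q → no-cex (x , p , ¬q))

module Enumeration where
  open import Data.Nat using (ℕ; zero; suc; _⊔_; _≤′_; ≤′-refl; ≤′-step)
  open import Data.Nat.Properties using (m≤m⊔n; m≤n⊔m; ≤⇒≤′)

  module Cumulative {A : Set} (new : ℕ → List A → List A) where
    level : ℕ → List A
    level zero    = []
    level (suc k) = level k ++ new k (level k)

    level-mono : ∀ {k m x} → k ≤′ m → x ∈ₗ level k → x ∈ₗ level m
    level-mono ≤′-refl      p = p
    level-mono (≤′-step le) p = ∈-++⁺ˡ (level-mono le p)

    raiseˡ : ∀ i j {x} → x ∈ₗ level i → x ∈ₗ level (i ⊔ j)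
    raiseˡ i j = level-mono (≤⇒≤′ (m≤m⊔n i j))

    raiseʳ : ∀ i j {x} → x ∈ₗ level j → x ∈ₗ level (i ⊔ j)
    raiseʳ i j = level-mono (≤⇒≤′ (m≤n⊔m i j))

    level-new : ∀ k {x} → x ∈ₗ new k (level k) → x ∈ₗ level (suc k)
    level-new k = ∈-++⁺ʳ (level k)

  pairs : {A : Set} → (A → A → A) → List A → List A
  pairs f xs = cartesianProductWith f xs xs

  newTerms : ℕ → List Jt → List Jt
  newTerms k ts = jvar k ∷ jconst k ∷ (pairs _·_ ts ++ pairs _⊕_ ts ++ map !_ ts)

  module Terms = Cumulative newTerms

  ·-new : ∀ {k ts s t} → s ∈ₗ ts → t ∈ₗ ts → s · t ∈ₗ newTerms k ts
  ·-new p q = there (there (∈-++⁺ˡ (∈-cartesianProductWith⁺ _·_ p q)))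

  ⊕-new : ∀ {k ts s t} → s ∈ₗ ts → t ∈ₗ ts → s ⊕ t ∈ₗ newTerms k ts
  ⊕-new {ts = ts} p q = there (there (∈-++⁺ʳ (pairs _·_ ts) (∈-++⁺ˡ (∈-cartesianProductWith⁺ _⊕_ p q))))

  !-new : ∀ {k ts t} → t ∈ₗ ts → ! t ∈ₗ newTerms k ts
  !-new {ts = ts} p = there (there (∈-++⁺ʳ (pairs _·_ ts) (∈-++⁺ʳ (pairs _⊕_ ts) (∈-map⁺ !_ p))))

  terms-complete : ∀ t → Σ ℕ λ k → t ∈ₗ Terms.level k
  terms-complete (jvar n)   = suc n , Terms.level-new n (here refl)
  terms-complete (jconst n) = suc n , Terms.level-new n (there (here refl))
  terms-complete (s · t) with terms-complete s | terms-complete t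
  ... | i , p | j , q = suc (i ⊔ j) , Terms.level-new (i ⊔ j) (·-new (Terms.raiseˡ i j p) (Terms.raiseʳ i j q))
  terms-complete (s ⊕ t) with terms-complete s | terms-complete t
  ... | i , p | j , q = suc (i ⊔ j) , Terms.level-new (i ⊔ j) (⊕-new (Terms.raiseˡ i j p) (Terms.raiseʳ i j q))
  terms-complete (! t) with terms-complete t
  ... | i , p = suc i , Terms.level-new i (!-new p)

  newFormulas : ℕ → List JFm → List JFm
  newFormulas k fs = jatom k ∷ ⊥ⱼ ∷
    (pairs _∧ⱼ_ fs ++ pairs _∨ⱼ_ fs ++ pairs _⇒ⱼ_ fs ++ cartesianProductWith _∶_ (Terms.level k) fs)

  module Formulas = Cumulative newFormulas

  ∧-new : ∀ {k fs a b} → a ∈ₗ fs → b ∈ₗ fs → a ∧ⱼ b ∈ₗ newFormulas k fs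
  ∧-new p q = there (there (∈-++⁺ˡ (∈-cartesianProductWith⁺ _∧ⱼ_ p q)))

  ∨-new : ∀ {k fs a b} → a ∈ₗ fs → b ∈ₗ fs → a ∨ⱼ b ∈ₗ newFormulas k fs
  ∨-new {fs = fs} p q = there (there (∈-++⁺ʳ (pairs _∧ⱼ_ fs) (∈-++⁺ˡ (∈-cartesianProductWith⁺ _∨ⱼ_ p q))))

  ⇒-new : ∀ {k fs a b} → a ∈ₗ fs → b ∈ₗ fs → (a ⇒ⱼ b) ∈ₗ newFormulas k fs
  ⇒-new {fs = fs} p q = there (there (∈-++⁺ʳ (pairs _∧ⱼ_ fs) (∈-++⁺ʳ (pairs _∨ⱼ_ fs)
    (∈-++⁺ˡ (∈-cartesianProductWith⁺ _⇒ⱼ_ p q)))))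

  ∶-new : ∀ {k fs t b} → t ∈ₗ Terms.level k → b ∈ₗ fs → t ∶ b ∈ₗ newFormulas k fs
  ∶-new {fs = fs} p q = there (there (∈-++⁺ʳ (pairs _∧ⱼ_ fs) (∈-++⁺ʳ (pairs _∨ⱼ_ fs) (∈-++⁺ʳ (pairs _⇒ⱼ_ fs)
    (∈-cartesianProductWith⁺ _∶_ p q)))))

  formulas : ℕ → List JFm
  formulas = Formulas.level

  formulas-complete : ∀ φ → Σ ℕ λ k → φ ∈ₗ formulas k
  formulas-complete (jatom n) = suc n , Formulas.level-new n (here refl)
  formulas-complete ⊥ⱼ        = 1 , Formulas.level-new 0 (there (here refl))
  formulas-complete (a ∧ⱼ b) with formulas-complete a | formulas-complete b
  ... | i , p | j , q = suc (i ⊔ j) , Formulas.level-new (i ⊔ j) (∧-new (Formulas.raiseˡ i j p) (Formulas.raiseʳ i j q))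
  formulas-complete (a ∨ⱼ b) with formulas-complete a | formulas-complete b
  ... | i , p | j , q = suc (i ⊔ j) , Formulas.level-new (i ⊔ j) (∨-new (Formulas.raiseˡ i j p) (Formulas.raiseʳ i j q))
  formulas-complete (a ⇒ⱼ b) with formulas-complete a | formulas-complete b
  ... | i , p | j , q = suc (i ⊔ j) , Formulas.level-new (i ⊔ j) (⇒-new (Formulas.raiseˡ i j p) (Formulas.raiseʳ i j q))
  formulas-complete (t ∶ b) with terms-complete t | formulas-complete b
  ... | i , p | j , q = suc (i ⊔ j) , Formulas.level-new (i ⊔ j) (∶-new (Terms.raiseˡ i j p) (Formulas.raiseʳ i j q))

module Lindenbaum (em : ExcludedMiddle (Level.suc 0ℓ)) (L : IntermediateLogic) (V : Variant) where
  open import Data.Nat using (ℕ; zero; suc; _⊔_; _≤′_; ≤′-refl; ≤′-step)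
  open import Data.Nat.Properties using (m≤m⊔n; m≤n⊔m; ≤⇒≤′)
  open Hilbert L V
  open Classical em using (em₀; dne₀)
  open Enumeration using (formulas; formulas-complete)
  open Tableau

  private
    variable
      Θ Ξ : Pred JFm 0ℓ

  infix 5 _▸_
  record Pair : Set₁ where
    constructor _▸_
    field
      left right : Pred JFm 0ℓ
  open Pair

  Cons : Pair → Set
  Cons P = Consistent L V (left P) (right P)

  _⊑_ : Pair → Pair → Set
  P ⊑ Q = left P ⊆ left Q × right P ⊆ right Q

  ⊑-refl : ∀ {P} → P ⊑ P
  ⊑-refl = (λ x → x) , (λ x → x)

  ⊑-trans : ∀ {P Q R} → P ⊑ Q → Q ⊑ R → P ⊑ R
  ⊑-trans (l , r) (l′ , r′) = l′ ∘ l , r′ ∘ r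

  place : (P : Pair) (φ : JFm) → Dec (Cons (left P ∪ ｛ φ ｝ ▸ right P)) → Pair
  place P φ (yes _) = left P ∪ ｛ φ ｝ ▸ right P
  place P φ (no _)  = left P ▸ right P ∪ ｛ φ ｝

  place-consistent : ∀ P φ d → Cons P → Cons (place P φ d)
  place-consistent P φ (yes c) _ = c
  place-consistent P φ (no ¬c) c = consistent-right c ¬c

  place-⊑ : ∀ P φ d → P ⊑ place P φ d
  place-⊑ P φ (yes _) = inj₁ , (λ x → x)
  place-⊑ P φ (no _)  = (λ x → x) , inj₁

  place-decides : ∀ P φ d → φ ∈ left (place P φ d) ⊎ φ ∈ right (place P φ d)
  place-decides P φ (yes _) = inj₁ (inj₂ refl)
  place-decides P φ (no _)  = inj₂ (inj₂ refl)

  placeAll : List JFm → Pair → Pair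
  placeAll []       P = P
  placeAll (φ ∷ φs) P = placeAll φs (place P φ em₀)

  placeAll-consistent : ∀ φs P → Cons P → Cons (placeAll φs P)
  placeAll-consistent []       P c = c
  placeAll-consistent (φ ∷ φs) P c = placeAll-consistent φs _ (place-consistent P φ em₀ c)

  placeAll-⊑ : ∀ φs P → P ⊑ placeAll φs P
  placeAll-⊑ []       P = ⊑-refl
  placeAll-⊑ (φ ∷ φs) P = ⊑-trans (place-⊑ P φ em₀) (placeAll-⊑ φs _)

  placeAll-decides : ∀ {φ} φs P → φ ∈ₗ φs → φ ∈ left (placeAll φs P) ⊎ φ ∈ right (placeAll φs P)
  placeAll-decides (φ ∷ φs) P (here refl) =
    Sum.map (proj₁ (placeAll-⊑ φs _)) (proj₂ (placeAll-⊑ φs _)) (place-decides P φ em₀)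
  placeAll-decides (φ ∷ φs) P (there m) = placeAll-decides φs _ m

  module Chain (P₀ : Pair) (c₀ : Cons P₀) where
    stage : ℕ → Pair
    stage zero    = P₀
    stage (suc k) = placeAll (formulas k) (stage k)

    stage-consistent : ∀ k → Cons (stage k)
    stage-consistent zero    = c₀
    stage-consistent (suc k) = placeAll-consistent (formulas k) (stage k) (stage-consistent k)

    stage-mono : ∀ {k m} → k ≤′ m → stage k ⊑ stage m
    stage-mono ≤′-refl      = ⊑-refl
    stage-mono {m = suc m} (≤′-step le) = ⊑-trans (stage-mono le) (placeAll-⊑ (formulas m) (stage m))

    stage-⊔ˡ : ∀ i j → stage i ⊑ stage (i ⊔ j)
    stage-⊔ˡ i j = stage-mono (≤⇒≤′ (m≤m⊔n i j))

    stage-⊔ʳ : ∀ i j → stage j ⊑ stage (i ⊔ j)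
    stage-⊔ʳ i j = stage-mono (≤⇒≤′ (m≤n⊔m i j))

    Γω Δω : Pred JFm 0ℓ
    Γω φ = Σ ℕ λ k → φ ∈ left (stage k)
    Δω φ = Σ ℕ λ k → φ ∈ right (stage k)

    derivation-in-stage : ∀ {χ} → Γω ⊢ χ → Σ ℕ λ k → left (stage k) ⊢ χ
    derivation-in-stage (ax x)        = 0 , ax x
    derivation-in-stage (hyp (k , m)) = k , hyp m
    derivation-in-stage (mp d e) with derivation-in-stage d | derivation-in-stage e
    ... | i , d′ | j , e′ =
      i ⊔ j , mp (weaken (proj₁ (stage-⊔ˡ i j)) d′) (weaken (proj₁ (stage-⊔ʳ i j)) e′)

    list-in-stage : ∀ {ds} → All Δω ds → Σ ℕ λ k → All (right (stage k)) ds
    list-in-stage []             = 0 , []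
    list-in-stage ((i , m) ∷ ps) with list-in-stage ps
    ... | j , qs = i ⊔ j , proj₂ (stage-⊔ˡ i j) m ∷ All.map (proj₂ (stage-⊔ʳ i j)) qs

    limit-consistent : Consistent L V Γω Δω
    limit-consistent ds ps d with derivation-in-stage d | list-in-stage ps
    ... | i , d′ | j , qs = stage-consistent (i ⊔ j) ds
      (All.map (proj₂ (stage-⊔ʳ i j)) qs) (weaken (proj₁ (stage-⊔ˡ i j)) d′)

    limit-maximal : Maximal L V Γω Δω
    limit-maximal φ with formulas-complete φ
    ... | k , m = Sum.map (suc k ,_) (suc k ,_) (placeAll-decides (formulas k) (stage k) m)

  lindenbaum : Consistent L V Θ Ξ → Σ (Tableau L V) λ τ → Θ ⊆ Γ τ × Ξ ⊆ Δ τ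
  lindenbaum {Θ} {Ξ} c =
    tableau Γω Δω limit-consistent limit-maximal , (0 ,_) , (0 ,_)
    where open Chain (Θ ▸ Ξ) c

  Refutation : Pred JFm 0ℓ → Pred JFm 0ℓ → Set
  Refutation Θ Ξ = Σ (List JFm) λ ds → All Ξ ds × Θ ⊢ ⋁ ds

  extend-or-refute : ∀ Θ Ξ → (Σ (Tableau L V) λ τ → Θ ⊆ Γ τ × Ξ ⊆ Δ τ) ⊎ Refutation Θ Ξ
  extend-or-refute Θ Ξ with em₀ {Consistent L V Θ Ξ}
  ... | yes c  = inj₁ (lindenbaum c)
  ... | no ¬c = inj₂ (dne₀ λ no-ref → ¬c λ ds ds∈Ξ d → no-ref (ds , ds∈Ξ , d))

module TruthLemma (em : ExcludedMiddle (Level.suc 0ℓ)) (L : IntermediateLogic) (V : Variant) where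
  open Hilbert L V
  open Lindenbaum em L V using (extend-or-refute)
  open Canonical L V
  open Tableau

  infix 3 _⊩_
  _⊩_ : Wsc → JFm → Set₁
  τ ⊩ α = _⊨ᶠ_ Msc τ α

  closed : ∀ (τ : Wsc) {φ} → Γ τ ⊢ φ → φ ∈ Γ τ
  closed τ {φ} d with maximal τ φ
  ... | inj₁ φ∈Γ = φ∈Γ
  ... | inj₂ φ∈Δ = ⊥-elim (consistent τ (φ ∷ []) (φ∈Δ ∷ []) d)

  forced⇒member : ∀ α {τ} → τ ⊩ α → α ∈ Γ τ
  member⇒forced : ∀ α {τ} → α ∈ Γ τ → τ ⊩ α

  forced⇒member (jatom p) f = lower f
  forced⇒member ⊥ⱼ        f = ⊥-elim (lower f)
  forced⇒member (a ∧ⱼ b) {τ} (fa , fb) =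
    closed τ (mp (mp (∧-intro a b) (hyp (forced⇒member a fa))) (hyp (forced⇒member b fb)))
  forced⇒member (a ∨ⱼ b) {τ} (inj₁ fa) = closed τ (mp (∨-introˡ a b) (hyp (forced⇒member a fa)))
  forced⇒member (a ∨ⱼ b) {τ} (inj₂ fb) = closed τ (mp (∨-introʳ a b) (hyp (forced⇒member b fb)))
  -- Either (Γ ∪ {a} , {b}) extends to a world forcing a but not b, or Γ, a ⊢ b.
  forced⇒member (a ⇒ⱼ b) {τ} f with extend-or-refute (Γ τ ∪ ｛ a ｝) ｛ b ｝
  ... | inj₁ (v , Γ⊆ , b∈Δ) = ⊥-elim (consistent v (b ∷ []) (b∈Δ refl ∷ [])
          (hyp (forced⇒member b (f v (Γ⊆ ∘ inj₁) (member⇒forced a (Γ⊆ (inj₂ refl)))))))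
  ... | inj₂ (ds , ds≡b , d) =
          closed τ (deduction (mp (⋁-elim (All.map (λ { refl → ⇒-refl b }) ds≡b)) d))
  forced⇒member (t ∶ a) f = lower (proj₁ f)

  member⇒forced (jatom p) m = lift m
  member⇒forced ⊥ⱼ {τ} m = ⊥-elim (consistent τ [] [] (hyp m))
  member⇒forced (a ∧ⱼ b) {τ} m =
    member⇒forced a (closed τ (mp (∧-elimˡ a b) (hyp m))) ,
    member⇒forced b (closed τ (mp (∧-elimʳ a b) (hyp m)))
  member⇒forced (a ∨ⱼ b) {τ} m with maximal τ a | maximal τ b
  ... | inj₁ a∈Γ | _        = inj₁ (member⇒forced a a∈Γ)
  ... | inj₂ _   | inj₁ b∈Γ = inj₂ (member⇒forced b b∈Γ)
  ... | inj₂ a∈Δ | inj₂ b∈Δ = ⊥-elim (consistent τ (a ∷ b ∷ []) (a∈Δ ∷ b∈Δ ∷ []) (hyp m))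
  member⇒forced (a ⇒ⱼ b) m v τ≼v fa =
    member⇒forced b (closed v (mp (hyp (τ≼v m)) (hyp (forced⇒member a fa))))
  member⇒forced (t ∶ a) m = lift m , λ v τRv → member⇒forced a (τRv t a m)

  right-unforced : ∀ (τ : Wsc) {P : Pred JFm 0ℓ} → P ⊆ Δ τ → ¬ (Σ JFm λ α → P α × τ ⊩ α)
  right-unforced τ P⊆Δ (α , p , f) = consistent τ (α ∷ []) (P⊆Δ p ∷ []) (hyp (forced⇒member α f))

module QuasiRealizations (em : ExcludedMiddle (Level.suc 0ℓ)) (L : IntermediateLogic) (V : Variant) where
  open Hilbert L V
  open Classical em using (all-or-counterexample)
  open Lindenbaum em L V using (Refutation; extend-or-refute)
  open TruthLemma em L V
  open Canonical L V
  open Tableau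

  infix 3 _⊩ᵐ_
  _⊩ᵐ_ : Wsc → MFm → Set₁
  τ ⊩ᵐ φ = _⊨ᵐ_ Nsc τ φ

  TQ FQ : IFm → Pred JFm 0ℓ
  TQ φ α = Quasi T φ (T , α)
  FQ φ α = Quasi F φ (F , α)

  some-TQ : ∀ φ → Σ JFm (TQ φ)
  some-FQ : ∀ φ → Σ JFm (FQ φ)

  some-TQ (iatom p)  = _ , qT-atom p
  some-TQ ⊥ᵢ         = _ , qT-⊥
  some-TQ (φ ∧ᵢ ψ)   = _ , qT-∧ (proj₂ (some-TQ φ)) (proj₂ (some-TQ ψ))
  some-TQ (φ ∨ᵢ ψ)   = _ , qT-∨ (proj₂ (some-TQ φ)) (proj₂ (some-TQ ψ))
  some-TQ (φ ⇒ᵢ ψ)   = _ , qT-⇒ (proj₂ (some-FQ φ)) (proj₂ (some-TQ ψ))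
  some-TQ (□[ n ] φ) = _ , qT-□ (proj₂ (some-TQ φ))

  some-FQ (iatom p)  = _ , qF-atom p
  some-FQ ⊥ᵢ         = _ , qF-⊥
  some-FQ (φ ∧ᵢ ψ)   = _ , qF-∧ (proj₂ (some-FQ φ)) (proj₂ (some-FQ ψ))
  some-FQ (φ ∨ᵢ ψ)   = _ , qF-∨ (proj₂ (some-FQ φ)) (proj₂ (some-FQ ψ))
  some-FQ (φ ⇒ᵢ ψ) with some-TQ φ | some-FQ ψ
  ... | a , qa | b , qb = _ , qF-⇒ a [] b [] (qa ∷ []) (qb ∷ [])
  some-FQ (□[ n ] φ) with some-FQ φ
  ... | b , qb = _ , qF-□ b [] (jvar 0) (qb ∷ [])

  SomeForced : IFm → Wsc → Set₁
  SomeForced φ τ = Σ JFm λ α → FQ φ α × τ ⊩ α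

  -- A refutation of (Γ ∪ TQ φ , FQ ψ) is, by compactness, an F-quasi-realization
  -- ⋀ αᵢ ⇒ ⋁ βⱼ of φ ⇒ ψ derivable from Γ.
  implication-witness : ∀ φ ψ (τ : Wsc) → Refutation (Γ τ ∪ TQ φ) (FQ ψ) → SomeForced (φ ⇒ᵢ ψ) τ
  implication-witness φ ψ τ (ds , ds∈FQ , d) with some-TQ φ
  ... | a , qa with compactness a d | nonempty-⋁ (proj₂ (some-FQ ψ)) ds∈FQ
  ... | hs , hs∈TQ , ⋀⇒⋁ | b , bs , bs∈FQ , ⋁⇒⋁⁺ =
    (⋀⁺ a hs ⇒ⱼ ⋁⁺ b bs) , qF-⇒ a hs b bs (qa ∷ hs∈TQ) bs∈FQ ,
    member⇒forced _ {τ} (closed τ (⇒-trans ⋀⇒⋁ ⋁⇒⋁⁺))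

  -- A refutation of (Γ^# , FQ φ) is, by lifting, an F-quasi-realization t : ⋁ βⱼ of
  -- □φ derivable from Γ.
  box-witness : ∀ n φ (τ : Wsc) → Refutation (Γ τ ♯) (FQ φ) → SomeForced (□[ n ] φ) τ
  box-witness n φ τ (ds , ds∈FQ , d) with nonempty-⋁ (proj₂ (some-FQ φ)) ds∈FQ
  ... | b , bs , bs∈FQ , ⋁⇒⋁⁺ with lifting (mp ⋁⇒⋁⁺ d)
  ... | t , ⊢t = t ∶ ⋁⁺ b bs , qF-□ b bs t bs∈FQ , member⇒forced _ {τ} (closed τ ⊢t)

  true-part  : ∀ φ τ → (∀ α → TQ φ α → τ ⊩ α) → τ ⊩ᵐ erase φ
  false-part : ∀ φ τ → τ ⊩ᵐ erase φ → SomeForced φ τ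

  true-part (iatom p) τ h = h (jatom p) (qT-atom p)
  true-part ⊥ᵢ        τ h = h ⊥ⱼ qT-⊥
  true-part (φ ∧ᵢ ψ)  τ h =
    true-part φ τ (λ α qα → proj₁ (h _ (qT-∧ qα (proj₂ (some-TQ ψ))))) ,
    true-part ψ τ (λ β qβ → proj₂ (h _ (qT-∧ (proj₂ (some-TQ φ)) qβ)))
  -- If some α ∈ TQ φ fails at τ, then each disjunction α ∨ β forces its β.
  true-part (φ ∨ᵢ ψ)  τ h with all-or-counterexample (TQ φ) (τ ⊩_)
  ... | inj₁ allφ           = inj₁ (true-part φ τ allφ)
  ... | inj₂ (α , qα , ¬fα) = inj₂ (true-part ψ τ λ β qβ →
          fromInj₂ (λ fα → contradiction fα ¬fα) (h (α ∨ⱼ β) (qT-∨ qα qβ)))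
  true-part (φ ⇒ᵢ ψ)  τ h v τ≼v vφ with false-part φ v vφ
  ... | α , qα , fα = true-part ψ v λ β qβ → h (α ⇒ⱼ β) (qT-⇒ qα qβ) v τ≼v fα
  true-part (□[ n ] φ) τ h v τRv = true-part φ v λ α qα → proj₂ (h (jvar n ∶ α) (qT-□ qα)) v τRv

  false-part (iatom p) τ f = jatom p , qF-atom p , f
  false-part ⊥ᵢ        τ f = ⊥ⱼ , qF-⊥ , f
  false-part (φ ∧ᵢ ψ)  τ (fφ , fψ) with false-part φ τ fφ | false-part ψ τ fψ
  ... | α , qα , fα | β , qβ , fβ = α ∧ⱼ β , qF-∧ qα qβ , fα , fβ
  false-part (φ ∨ᵢ ψ)  τ (inj₁ fφ) with false-part φ τ fφ
  ... | α , qα , fα = _ , qF-∨ qα (proj₂ (some-FQ ψ)) , inj₁ fα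
  false-part (φ ∨ᵢ ψ)  τ (inj₂ fψ) with false-part ψ τ fψ
  ... | β , qβ , fβ = _ , qF-∨ (proj₂ (some-FQ φ)) qβ , inj₂ fβ
  -- An extension v of (Γ ∪ TQ φ , FQ ψ) would force φ, hence ψ, hence a member of Δ v.
  false-part (φ ⇒ᵢ ψ)  τ f with extend-or-refute (Γ τ ∪ TQ φ) (FQ ψ)
  ... | inj₂ refutation     = implication-witness φ ψ τ refutation
  ... | inj₁ (v , Γ⊆ , FQ⊆Δ) = ⊥-elim (right-unforced v FQ⊆Δ (false-part ψ v
          (f v (Γ⊆ ∘ inj₁) (true-part φ v λ α qα → member⇒forced α (Γ⊆ (inj₂ qα))))))
  -- An extension v of (Γ^# , FQ φ) is an R-successor, so it forces φ and a member of Δ v.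
  false-part (□[ n ] φ) τ f with extend-or-refute (Γ τ ♯) (FQ φ)
  ... | inj₂ refutation     = box-witness n φ τ refutation
  ... | inj₁ (v , Γ♯⊆ , FQ⊆Δ) =
          ⊥-elim (right-unforced v FQ⊆Δ (false-part φ v (f v λ t ψ m → Γ♯⊆ (t , m))))

open import Level using (suc; zero)

mainTheorem8 : ExcludedMiddle (suc zero) →
    (L : IntermediateLogic) (V : Variant) (φ' : IFm) → UniquelyAnnotated φ' →
    (τ : Canonical.Wsc L V) →
      ((∀ α → Quasi T φ' (T , α) → _⊨ᶠ_ (Canonical.Msc L V) τ α) →
         _⊨ᵐ_ (Canonical.Nsc L V) τ (erase φ'))
      ×
      ((∀ α → Quasi F φ' (F , α) → ¬ (_⊨ᶠ_ (Canonical.Msc L V) τ α)) →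
         ¬ (_⊨ᵐ_ (Canonical.Nsc L V) τ (erase φ')))
mainTheorem8 em L V φ' _ τ =
  true-part φ' τ , λ none-forced forced →
    let α , qα , fα = false-part φ' τ forced in none-forced α qα fα
  where open QuasiRealizations em L V
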